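{- Let $P$ be a total GPEA and let $U$ be the unitization of $P$ by a unitizing GPEA-automorphism $\gamma$. Then $P$ has RDP (RDP$_0$, RDP$_1$, RDP$_2$, respectively) iff $U$ has RDP (RDP$_0$, RDP$_1$, RDP$_2$, respectively).
   Context: $P$ is a GPEA (partial $\oplus$, constant $0$; partial associativity; conjugation; two-sided cancellation; neutral $0$; positivity), ordered by $a\le b$ iff $a\oplus c=b$ for some $c$; for $a\le b$, $a/b$ is the unique $c$ with $a\oplus c=b$ and $b\backslash a$ the unique $d$ with $d\oplus a=b$. $P$ is total iff $a\oplus b$ is defined for all $a,b$. $\gamma$ is a unitizing GPEA-automorphism ($\gamma a\oplus b$ defined iff $b\oplus a$ defined). The unitization by $\gamma$ ($\gamma$-unitization) $U=P\cup P^\eta$ ($\eta$ a bijection onto a disjoint set, $1:=\eta0$): sums in $P$ as in $P$; $a+\eta b$ defined iff $a\le b$, equal to $\eta(b\backslash a)$; $\eta a+b$ defined iff $\gamma b\le a$, equal to $\eta(\gamma b/a)$; no sums within $P^\eta$; $U$ is a pseudo effect algebra. RDP: whenever $a\oplus b=c\oplus d$ there are $e_{11},e_{12},e_{21},e_{22}$ with $a=e_{11}\oplus e_{12}$, $b=e_{21}\oplus e_{22}$, $c=e_{11}\oplus e_{21}$, $d=e_{12}\oplus e_{22}$. RDP$_1$: moreover the decomposition can be chosen so that whenever $f\le e_{12}$, $g\le e_{21}$, then $f\oplus g=g\oplus f$. RDP$_2$: moreover $e_{12}\wedge e_{21}=0$. RDP$_0$: if $a\le b\oplus c$ then $a=b_1\oplus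 c_1$ for some $b_1\le b$, $c_1\le c$. -}

module Defs where

open import Data.Product using (Σ; ∃; ∃-syntax; _×_; _,_)
open import Data.Sum using (_⊎_; inj₁; inj₂)
open import Relation.Binary.PropositionalEquality using (_≡_)
open import Function.Bundles using (_⇔_)
open import Function.Definitions using (Bijective)

-- Partial algebras: a carrier, a partial binary operation ⊕ given as
-- its graph  Sum a b c  ("a ⊕ b is defined and equals c"), and 0.

record PartialAlg : Set₁ where
  field
    Carrier : Set
    Sum     : Carrier → Carrier → Carrier → Set
    𝟘       : Carrier

module _ (A : PartialAlg) where
  open PartialAlg A

  _≤_ : Carrier → Carrier → Set
  a ≤ b = ∃[ c ] Sum a c b

  RDP : Set
  RDP = ∀ a b c d s → Sum a b s → Sum c d s →
        ∃[ e₁₁ ] ∃[ e₁₂ ] ∃[ e₂₁ ] ∃[ e₂₂ ]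
          (Sum e₁₁ e₁₂ a × Sum e₂₁ e₂₂ b × Sum e₁₁ e₂₁ c × Sum e₁₂ e₂₂ d)

  RDP₁ : Set
  RDP₁ = ∀ a b c d s → Sum a b s → Sum c d s →
         ∃[ e₁₁ ] ∃[ e₁₂ ] ∃[ e₂₁ ] ∃[ e₂₂ ]
           (Sum e₁₁ e₁₂ a × Sum e₂₁ e₂₂ b × Sum e₁₁ e₂₁ c × Sum e₁₂ e₂₂ d
           × (∀ f g → f ≤ e₁₂ → g ≤ e₂₁ → ∃[ h ] (Sum f g h × Sum g f h)))

  -- RDP₂: additionally e₁₂ ∧ e₂₁ = 0, i.e. 0 is the greatest lower bound
  -- of e₁₂ and e₂₁ (0 is always a lower bound)
  RDP₂ : Set
  RDP₂ = ∀ a b c d s → Sum a b s → Sum c d s →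
         ∃[ e₁₁ ] ∃[ e₁₂ ] ∃[ e₂₁ ] ∃[ e₂₂ ]
           (Sum e₁₁ e₁₂ a × Sum e₂₁ e₂₂ b × Sum e₁₁ e₂₁ c × Sum e₁₂ e₂₂ d
           × (∀ x → x ≤ e₁₂ → x ≤ e₂₁ → x ≡ 𝟘))

  RDP₀ : Set
  RDP₀ = ∀ a b c s → Sum b c s → a ≤ s →
         ∃[ b₁ ] ∃[ c₁ ] (b₁ ≤ b × c₁ ≤ c × Sum b₁ c₁ a)

record IsGPEA (A : PartialAlg) : Set where
  open PartialAlg A
  field
    functional : ∀ {a b c c'} → Sum a b c → Sum a b c' → c ≡ c'
    assocʳ : ∀ {a b c d e} → Sum a b d → Sum d c e → ∃[ f ] (Sum b c f × Sum a f e)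
    assocˡ : ∀ {a b c f e} → Sum b c f → Sum a f e → ∃[ d ] (Sum a b d × Sum d c e)
    conjugation : ∀ {a b c} → Sum a b c → ∃[ d ] Sum d a c × ∃[ e ] Sum b e c
    cancelˡ : ∀ {a b b' c} → Sum a b c → Sum a b' c → b ≡ b'
    cancelʳ : ∀ {a a' b c} → Sum a b c → Sum a' b c → a ≡ a'
    neutralʳ : ∀ a → Sum a 𝟘 a
    neutralˡ : ∀ a → Sum 𝟘 a a
    positivity : ∀ {a b} → Sum a b 𝟘 → a ≡ 𝟘 × b ≡ 𝟘

record GPEA : Set₁ where
  field
    alg    : PartialAlg
    isGPEA : IsGPEA alg
  open PartialAlg alg public
  open IsGPEA isGPEA public

Total : GPEA → Set
Total P = ∀ a b → ∃[ c ] Sum a b c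
  where open GPEA P

record UnitizingAutomorphism (P : GPEA) : Set where
  open GPEA P
  field
    γ          : Carrier → Carrier
    bijective  : Bijective _≡_ _≡_ γ
    preserves  : ∀ a b c → Sum a b c ⇔ Sum (γ a) (γ b) (γ c)
    unitizing  : ∀ a b → (∃[ c ] Sum (γ a) b c) ⇔ (∃[ c ] Sum b a c)

-- The γ-unitization U = P ∪ P^η, with η = inj₂ and 1 = η 0.

module _ (P : GPEA) (Γ : UnitizingAutomorphism P) where
  open GPEA P
  open UnitizingAutomorphism Γ

  data USum : Carrier ⊎ Carrier → Carrier ⊎ Carrier → Carrier ⊎ Carrier → Set where
    inP  : ∀ {a b c} → Sum a b c → USum (inj₁ a) (inj₁ b) (inj₁ c)
    -- a + η b defined iff a ≤ b, equal to η (b \ a), where (b \ a) ⊕ a = b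
    inPη : ∀ {a b d} → Sum d a b → USum (inj₁ a) (inj₂ b) (inj₂ d)
    -- η a + b defined iff γ b ≤ a, equal to η (γ b / a), where γ b ⊕ (γ b / a) = a
    inηP : ∀ {a b c} → Sum (γ b) c a → USum (inj₂ a) (inj₁ b) (inj₂ c)
    -- no sums within P^η

  Unitization : PartialAlg
  Unitization = record { Carrier = Carrier ⊎ Carrier ; Sum = USum ; 𝟘 = inj₁ 𝟘 }

module Submission where

-- RDP, RDP₁ and RDP₂ are instances of one scheme: a Riesz
-- decomposition of a ⊕ b = c ⊕ d whose cross terms e₁₂, e₂₁ satisfy a side
-- condition R.  Since summands in U of elements of P lie in P, a decomposition
-- in U of an equation in P is one in P: this gives every implication U ⇒ P.
-- For P ⇒ U, totality makes ⊕ a total cancellative monoid operation, in which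
-- the cross terms of any Riesz decomposition commute.  An equation in U with a
-- sum in P^η has both sides of shape (P,η) or (η,P).  Mixed shapes admit a
-- decomposition with a zero cross term; equal shapes are decomposed along a
-- common left (resp. right) part of the two P-summands, found by RDP in P.
-- Zero cross terms satisfy the RDP₁/RDP₂ conditions in U, and these conditions
-- lift from P to U.  RDP₀ is handled directly by the same case analysis.

open import Defs
open import Data.Product using (_×_; ∃-syntax; _,_; proj₁; proj₂)
open import Data.Sum using (_⊎_; inj₁; inj₂)
open import Data.Unit using (⊤; tt)
open import Function.Bundles using (_⇔_; mk⇔; Equivalence)
open import Relation.Binary.PropositionalEquality
  using (_≡_; refl; sym; trans; cong; cong₂; subst; module ≡-Reasoning)

module _ (A : PartialAlg) where
  open PartialAlg A

  Decomposition : (Carrier → Carrier → Set) → (a b c d : Carrier) → Set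
  Decomposition R a b c d =
    ∃[ e₁₁ ] ∃[ e₁₂ ] ∃[ e₂₁ ] ∃[ e₂₂ ]
      (Sum e₁₁ e₁₂ a × Sum e₂₁ e₂₂ b × Sum e₁₁ e₂₁ c × Sum e₁₂ e₂₂ d × R e₁₂ e₂₁)

  RieszWith : (Carrier → Carrier → Set) → Set
  RieszWith R = ∀ a b c d s → Sum a b s → Sum c d s → Decomposition R a b c d

  -- The side conditions of RDP₁ and RDP₂; RDP₁ A and RDP₂ A unfold to
  -- RieszWith A Commuting and RieszWith A Disjoint.
  Commuting : Carrier → Carrier → Set
  Commuting p q = ∀ f g → _≤_ A f p → _≤_ A g q → ∃[ h ] (Sum f g h × Sum g f h)

  Disjoint : Carrier → Carrier → Set
  Disjoint p q = ∀ x → _≤_ A x p → _≤_ A x q → x ≡ 𝟘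

  rdp⇔riesz⊤ : RDP A ⇔ RieszWith (λ _ _ → ⊤)
  rdp⇔riesz⊤ = mk⇔ addTrivial dropTrivial
    where
    addTrivial : RDP A → RieszWith (λ _ _ → ⊤)
    addTrivial rdp a b c d s ab cd with rdp a b c d s ab cd
    ... | e₁₁ , e₁₂ , e₂₁ , e₂₂ , s₁ , s₂ , s₃ , s₄ = e₁₁ , e₁₂ , e₂₁ , e₂₂ , s₁ , s₂ , s₃ , s₄ , tt

    dropTrivial : RieszWith (λ _ _ → ⊤) → RDP A
    dropTrivial riesz a b c d s ab cd with riesz a b c d s ab cd
    ... | e₁₁ , e₁₂ , e₂₁ , e₂₂ , s₁ , s₂ , s₃ , s₄ , _ = e₁₁ , e₁₂ , e₂₁ , e₂₂ , s₁ , s₂ , s₃ , s₄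

module TotalArithmetic (P : GPEA) (total : Total P) where
  open GPEA P

  infixl 6 _+_
  _+_ : Carrier → Carrier → Carrier
  a + b = proj₁ (total a b)

  sum-+ : ∀ a b → Sum a b (a + b)
  sum-+ a b = proj₂ (total a b)

  sum⇒≡ : ∀ {a b c} → Sum a b c → a + b ≡ c
  sum⇒≡ {a} {b} = functional (sum-+ a b)

  ≡⇒sum : ∀ {a b c} → a + b ≡ c → Sum a b c
  ≡⇒sum {a} {b} refl = sum-+ a b

  +-assoc : ∀ a b c → (a + b) + c ≡ a + (b + c)
  +-assoc a b c with assocʳ (sum-+ a b) (sum-+ (a + b) c)
  ... | _ , bc , a[bc] = trans (sym (sum⇒≡ a[bc])) (cong (a +_) (sym (sum⇒≡ bc)))

  +-cancelˡ : ∀ {a b b'} → a + b ≡ a + b' → b ≡ b'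
  +-cancelˡ {a} {b} eq = cancelˡ (sum-+ a b) (≡⇒sum (sym eq))

  +-cancelʳ : ∀ {a a' b} → a + b ≡ a' + b → a ≡ a'
  +-cancelʳ {a} {b = b} eq = cancelʳ (sum-+ a b) (≡⇒sum (sym eq))

  swapˡ : ∀ {x y} z → x + y ≡ y + x → x + (y + z) ≡ y + (x + z)
  swapˡ {x} {y} z xy = begin
    x + (y + z) ≡⟨ sym (+-assoc x y z) ⟩
    (x + y) + z ≡⟨ cong (_+ z) xy ⟩
    (y + x) + z ≡⟨ +-assoc y x z ⟩
    y + (x + z) ∎
    where open ≡-Reasoning

  swapʳ : ∀ {y z} x → y + z ≡ z + y → (x + y) + z ≡ (x + z) + y
  swapʳ {y} {z} x yz = begin
    (x + y) + z ≡⟨ +-assoc x y z ⟩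
    x + (y + z) ≡⟨ cong (x +_) yz ⟩
    x + (z + y) ≡⟨ sym (+-assoc x z y) ⟩
    (x + z) + y ∎
    where open ≡-Reasoning

  -- The cross terms of any Riesz decomposition commute: cancel the outer
  -- terms of (e₁₁ + e₁₂) + (e₂₁ + e₂₂) = (e₁₁ + e₂₁) + (e₁₂ + e₂₂).
  crossTermsCommute : ∀ {a b c d s e₁₁ e₁₂ e₂₁ e₂₂} → Sum a b s → Sum c d s →
    Sum e₁₁ e₁₂ a → Sum e₂₁ e₂₂ b → Sum e₁₁ e₂₁ c → Sum e₁₂ e₂₂ d →
    e₁₂ + e₂₁ ≡ e₂₁ + e₁₂
  crossTermsCommute {a} {b} {c} {d} {s} {e₁₁} {e₁₂} {e₂₁} {e₂₂} ab cd s₁ s₂ s₃ s₄ =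
    +-cancelʳ (+-cancelˡ (begin
      e₁₁ + ((e₁₂ + e₂₁) + e₂₂) ≡⟨ sym (regroup e₁₁ e₁₂ e₂₁ e₂₂) ⟩
      (e₁₁ + e₁₂) + (e₂₁ + e₂₂) ≡⟨ cong₂ _+_ (sum⇒≡ s₁) (sum⇒≡ s₂) ⟩
      a + b                     ≡⟨ sum⇒≡ ab ⟩
      s                         ≡⟨ sym (sum⇒≡ cd) ⟩
      c + d                     ≡⟨ sym (cong₂ _+_ (sum⇒≡ s₃) (sum⇒≡ s₄)) ⟩
      (e₁₁ + e₂₁) + (e₁₂ + e₂₂) ≡⟨ regroup e₁₁ e₂₁ e₁₂ e₂₂ ⟩
      e₁₁ + ((e₂₁ + e₁₂) + e₂₂) ∎))
    where
    open ≡-Reasoning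
    regroup : ∀ w x y z → (w + x) + (y + z) ≡ w + ((x + y) + z)
    regroup w x y z = trans (+-assoc w x (y + z)) (cong (w +_) (sym (+-assoc x y z)))

  module _ {R : Carrier → Carrier → Set} (riesz : RieszWith alg R) where

    commonLeftPart : ∀ a c → ∃[ f₁₁ ] ∃[ f₁₂ ] ∃[ f₂₁ ]
      (Sum f₁₁ f₁₂ a × Sum f₁₁ f₂₁ c × f₁₂ + f₂₁ ≡ f₂₁ + f₁₂ × R f₁₂ f₂₁)
    commonLeftPart a c with conjugation (sum-+ a c)
    ... | _ , _ , e , ce with riesz a c c e (a + c) (sum-+ a c) ce
    ... | f₁₁ , f₁₂ , f₂₁ , _ , s₁ , s₂ , s₃ , s₄ , r =
      f₁₁ , f₁₂ , f₂₁ , s₁ , s₃ , crossTermsCommute (sum-+ a c) ce s₁ s₂ s₃ s₄ , r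

    commonRightPart : ∀ z y → ∃[ f₁₂ ] ∃[ f₂₁ ] ∃[ f₂₂ ]
      (Sum f₁₂ f₂₂ z × Sum f₂₁ f₂₂ y × f₁₂ + f₂₁ ≡ f₂₁ + f₁₂ × R f₁₂ f₂₁)
    commonRightPart z y with conjugation (sum-+ z y)
    ... | d , dz , _ with riesz z y d z (z + y) (sum-+ z y) dz
    ... | _ , f₁₂ , f₂₁ , f₂₂ , s₁ , s₂ , s₃ , s₄ , r =
      f₁₂ , f₂₁ , f₂₂ , s₄ , s₂ , crossTermsCommute (sum-+ z y) dz s₁ s₂ s₃ s₄ , r

module UnitizationBasics (P : GPEA) (Γ : UnitizingAutomorphism P) where
  open GPEA P
  open UnitizingAutomorphism Γ

  U : PartialAlg
  U = Unitization P Γ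

  γ-sum : ∀ {a b c} → Sum a b c → Sum (γ a) (γ b) (γ c)
  γ-sum {a} {b} {c} = Equivalence.to (preserves a b c)

  γ-𝟘 : γ 𝟘 ≡ 𝟘
  γ-𝟘 = cancelˡ (γ-sum (neutralˡ 𝟘)) (neutralʳ (γ 𝟘))

  zero+ : ∀ x → USum P Γ (inj₁ 𝟘) x x
  zero+ (inj₁ x) = inP (neutralˡ x)
  zero+ (inj₂ x) = inPη (neutralʳ x)

  +zero : ∀ x → USum P Γ x (inj₁ 𝟘) x
  +zero (inj₁ x) = inP (neutralʳ x)
  +zero (inj₂ x) = inηP (subst (λ z → Sum z x x) (sym γ-𝟘) (neutralˡ x))

  below-zero : ∀ {x} → _≤_ U x (inj₁ 𝟘) → x ≡ inj₁ 𝟘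
  below-zero (_ , inP s) = cong inj₁ (proj₁ (positivity s))

  commuting-lift : ∀ {p q} → Commuting alg p q → Commuting U (inj₁ p) (inj₁ q)
  commuting-lift com (inj₁ f) (inj₁ g) (_ , inP f≤p) (_ , inP g≤q) with com f g (_ , f≤p) (_ , g≤q)
  ... | h , fg , gf = inj₁ h , inP fg , inP gf

  commuting-zeroˡ : ∀ q → Commuting U (inj₁ 𝟘) q
  commuting-zeroˡ q f g f≤0 _ with below-zero f≤0
  ... | refl = g , zero+ g , +zero g

  commuting-zeroʳ : ∀ p → Commuting U p (inj₁ 𝟘)
  commuting-zeroʳ p f g _ g≤0 with below-zero g≤0
  ... | refl = f , +zero f , zero+ f

  commuting-restrict : ∀ {p q} → Commuting U (inj₁ p) (inj₁ q) → Commuting alg p q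
  commuting-restrict com f g (_ , f≤p) (_ , g≤q) with com (inj₁ f) (inj₁ g) (_ , inP f≤p) (_ , inP g≤q)
  ... | _ , inP fg , inP gf = _ , fg , gf

  disjoint-lift : ∀ {p q} → Disjoint alg p q → Disjoint U (inj₁ p) (inj₁ q)
  disjoint-lift dis (inj₁ x) (_ , inP x≤p) (_ , inP x≤q) = cong inj₁ (dis x (_ , x≤p) (_ , x≤q))

  disjoint-zeroˡ : ∀ q → Disjoint U (inj₁ 𝟘) q
  disjoint-zeroˡ q x x≤0 _ = below-zero x≤0

  disjoint-zeroʳ : ∀ p → Disjoint U p (inj₁ 𝟘)
  disjoint-zeroʳ p x _ x≤0 = below-zero x≤0

  disjoint-restrict : ∀ {p q} → Disjoint U (inj₁ p) (inj₁ q) → Disjoint alg p q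
  disjoint-restrict dis x (_ , x≤p) (_ , x≤q) with dis (inj₁ x) (_ , inP x≤p) (_ , inP x≤q)
  ... | refl = refl

  -- P is closed under summands in U, so a Riesz property of U restricts to P.
  riesz-restrict : ∀ {R₀ R} → (∀ {p q} → R (inj₁ p) (inj₁ q) → R₀ p q) →
    RieszWith U R → RieszWith alg R₀
  riesz-restrict restrict riesz a b c d s ab cd
    with riesz (inj₁ a) (inj₁ b) (inj₁ c) (inj₁ d) (inj₁ s) (inP ab) (inP cd)
  ... | _ , _ , _ , _ , inP s₁ , inP s₂ , inP s₃ , inP s₄ , r = _ , _ , _ , _ , s₁ , s₂ , s₃ , s₄ , restrict r

  rdp₀-restrict : RDP₀ U → RDP₀ alg
  rdp₀-restrict rdp₀ a b c s bc (x , ax)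
    with rdp₀ (inj₁ a) (inj₁ b) (inj₁ c) (inj₁ s) (inP bc) (inj₁ x , inP ax)
  ... | _ , _ , (_ , inP b₁b) , (_ , inP c₁c) , inP a≡ = _ , _ , (_ , b₁b) , (_ , c₁c) , a≡

module UnitizationOfTotal (P : GPEA) (total : Total P) (Γ : UnitizingAutomorphism P) where
  open GPEA P
  open UnitizingAutomorphism Γ
  open TotalArithmetic P total
  open UnitizationBasics P Γ
  open ≡-Reasoning

  γ-+ : ∀ a b → γ (a + b) ≡ γ a + γ b
  γ-+ a b = sym (sum⇒≡ (γ-sum (sum-+ a b)))

  γ-comm : ∀ {a b} → a + b ≡ b + a → γ a + γ b ≡ γ b + γ a
  γ-comm {a} {b} ab = trans (sym (γ-+ a b)) (trans (cong γ ab) (γ-+ b a))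

  module _ {R₀ : Carrier → Carrier → Set} {R : Carrier ⊎ Carrier → Carrier ⊎ Carrier → Set}
           (lift : ∀ {p q} → R₀ p q → R (inj₁ p) (inj₁ q))
           (zeroˡ : ∀ q → R (inj₁ 𝟘) q) (zeroʳ : ∀ p → R p (inj₁ 𝟘))
           (riesz : RieszWith alg R₀) where

    -- a + ηB = c + ηD: split a and c along a common left part.
    case-Pη-Pη : ∀ {a B c D S} → Sum S a B → Sum S c D →
      Decomposition U R (inj₁ a) (inj₂ B) (inj₁ c) (inj₂ D)
    case-Pη-Pη {a} {B} {c} {D} {S} Sa Sc with commonLeftPart riesz a c
    ... | f₁₁ , f₁₂ , f₂₁ , a≡ , c≡ , comm , r =
      inj₁ f₁₁ , inj₁ f₁₂ , inj₁ f₂₁ , inj₂ (B + f₂₁) ,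
      inP a≡ , inPη (sum-+ B f₂₁) , inP c≡ , inPη (≡⇒sum D+f₁₂) , lift r
      where
      D+f₁₂ : D + f₁₂ ≡ B + f₂₁
      D+f₁₂ = begin
        D + f₁₂                 ≡⟨ cong (λ x → x + f₁₂) (sym (sum⇒≡ Sc)) ⟩
        S + c + f₁₂             ≡⟨ cong (λ x → S + x + f₁₂) (sym (sum⇒≡ c≡)) ⟩
        S + (f₁₁ + f₂₁) + f₁₂   ≡⟨ cong (_+ f₁₂) (sym (+-assoc S f₁₁ f₂₁)) ⟩
        S + f₁₁ + f₂₁ + f₁₂     ≡⟨ swapʳ (S + f₁₁) (sym comm) ⟩
        S + f₁₁ + f₁₂ + f₂₁     ≡⟨ cong (_+ f₂₁) (+-assoc S f₁₁ f₁₂) ⟩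
        S + (f₁₁ + f₁₂) + f₂₁   ≡⟨ cong (λ x → S + x + f₂₁) (sum⇒≡ a≡) ⟩
        S + a + f₂₁             ≡⟨ cong (_+ f₂₁) (sum⇒≡ Sa) ⟩
        B + f₂₁                 ∎

    -- ηA + y = ηC + z: split z and y along a common right part.
    case-ηP-ηP : ∀ {A y C z S} → Sum (γ y) S A → Sum (γ z) S C →
      Decomposition U R (inj₂ A) (inj₁ y) (inj₂ C) (inj₁ z)
    case-ηP-ηP {A} {y} {C} {z} {S} yS zS with commonRightPart riesz z y
    ... | f₁₂ , f₂₁ , f₂₂ , z≡ , y≡ , comm , r =
      inj₂ (γ f₁₂ + A) , inj₁ f₁₂ , inj₁ f₂₁ , inj₁ f₂₂ ,
      inηP (sum-+ (γ f₁₂) A) , inP y≡ , inηP (≡⇒sum γf₂₁+C) , inP z≡ , lift r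
      where
      γf₂₁+C : γ f₂₁ + C ≡ γ f₁₂ + A
      γf₂₁+C = begin
        γ f₂₁ + C                         ≡⟨ cong (γ f₂₁ +_) (sym (sum⇒≡ zS)) ⟩
        γ f₂₁ + (γ z + S)                 ≡⟨ cong (λ x → γ f₂₁ + (γ x + S)) (sym (sum⇒≡ z≡)) ⟩
        γ f₂₁ + (γ (f₁₂ + f₂₂) + S)       ≡⟨ cong (λ x → γ f₂₁ + (x + S)) (γ-+ f₁₂ f₂₂) ⟩
        γ f₂₁ + (γ f₁₂ + γ f₂₂ + S)       ≡⟨ cong (γ f₂₁ +_) (+-assoc (γ f₁₂) (γ f₂₂) S) ⟩
        γ f₂₁ + (γ f₁₂ + (γ f₂₂ + S))     ≡⟨ swapˡ (γ f₂₂ + S) (γ-comm (sym comm)) ⟩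
        γ f₁₂ + (γ f₂₁ + (γ f₂₂ + S))     ≡⟨ cong (γ f₁₂ +_) (sym (+-assoc (γ f₂₁) (γ f₂₂) S)) ⟩
        γ f₁₂ + (γ f₂₁ + γ f₂₂ + S)       ≡⟨ cong (λ x → γ f₁₂ + (x + S)) (sym (γ-+ f₂₁ f₂₂)) ⟩
        γ f₁₂ + (γ (f₂₁ + f₂₂) + S)       ≡⟨ cong (λ x → γ f₁₂ + (γ x + S)) (sum⇒≡ y≡) ⟩
        γ f₁₂ + (γ y + S)                 ≡⟨ cong (γ f₁₂ +_) (sum⇒≡ yS) ⟩
        γ f₁₂ + A                         ∎

    case-Pη-ηP : ∀ {a B C z S} → Sum S a B → Sum (γ z) S C →
      Decomposition U R (inj₁ a) (inj₂ B) (inj₂ C) (inj₁ z)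
    case-Pη-ηP {a} {B} {C} {z} {S} Sa zS =
      inj₁ a , inj₁ 𝟘 , inj₂ (C + a) , inj₁ z ,
      inP (neutralʳ a) , inηP (≡⇒sum γz+B) , inPη (sum-+ C a) , inP (neutralˡ z) , zeroˡ _
      where
      γz+B : γ z + B ≡ C + a
      γz+B = begin
        γ z + B         ≡⟨ cong (γ z +_) (sym (sum⇒≡ Sa)) ⟩
        γ z + (S + a)   ≡⟨ sym (+-assoc (γ z) S a) ⟩
        γ z + S + a     ≡⟨ cong (_+ a) (sum⇒≡ zS) ⟩
        C + a           ∎

    case-ηP-Pη : ∀ {A y c D S} → Sum (γ y) S A → Sum S c D →
      Decomposition U R (inj₂ A) (inj₁ y) (inj₁ c) (inj₂ D)
    case-ηP-Pη {A} {y} {c} {D} {S} yS Sc =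
      inj₁ c , inj₂ (A + c) , inj₁ 𝟘 , inj₁ y ,
      inPη (sum-+ A c) , inP (neutralˡ y) , inP (neutralʳ c) , inηP (≡⇒sum γy+D) , zeroʳ _
      where
      γy+D : γ y + D ≡ A + c
      γy+D = begin
        γ y + D         ≡⟨ cong (γ y +_) (sym (sum⇒≡ Sc)) ⟩
        γ y + (S + c)   ≡⟨ sym (+-assoc (γ y) S c) ⟩
        γ y + S + c     ≡⟨ cong (_+ c) (sum⇒≡ yS) ⟩
        A + c           ∎

    riesz-extend : RieszWith U R
    riesz-extend (inj₁ a) (inj₁ b) (inj₁ c) (inj₁ d) (inj₁ s) (inP ab) (inP cd)
      with riesz a b c d s ab cd
    ... | e₁₁ , e₁₂ , e₂₁ , e₂₂ , s₁ , s₂ , s₃ , s₄ , r =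
      inj₁ e₁₁ , inj₁ e₁₂ , inj₁ e₂₁ , inj₁ e₂₂ , inP s₁ , inP s₂ , inP s₃ , inP s₄ , lift r
    riesz-extend _ _ _ _ _ (inPη Sa) (inPη Sc) = case-Pη-Pη Sa Sc
    riesz-extend _ _ _ _ _ (inηP yS) (inηP zS) = case-ηP-ηP yS zS
    riesz-extend _ _ _ _ _ (inPη Sa) (inηP zS) = case-Pη-ηP Sa zS
    riesz-extend _ _ _ _ _ (inηP yS) (inPη Sc) = case-ηP-Pη yS Sc

  rdp₀-Pη : ∀ a {b B S} → Sum S b B → _≤_ U a (inj₂ S) →
    ∃[ b₁ ] ∃[ c₁ ] (_≤_ U b₁ (inj₁ b) × _≤_ U c₁ (inj₂ B) × USum P Γ b₁ c₁ a)
  rdp₀-Pη _ {b} {B} _ (_ , inPη {a} _) =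
    inj₁ 𝟘 , inj₁ a , (inj₁ b , inP (neutralˡ b)) , (inj₂ (B + a) , inPη (sum-+ B a)) , inP (neutralˡ a)
  rdp₀-Pη _ {b} {B} {S} Sb (_ , inηP {A} {t} tS) =
    inj₁ b , inj₂ (A + b) , (inj₁ 𝟘 , inP (neutralʳ b)) , (inj₁ t , inηP (≡⇒sum γt+B)) , inPη (sum-+ A b)
    where
    γt+B : γ t + B ≡ A + b
    γt+B = begin
      γ t + B         ≡⟨ cong (γ t +_) (sym (sum⇒≡ Sb)) ⟩
      γ t + (S + b)   ≡⟨ sym (+-assoc (γ t) S b) ⟩
      γ t + S + b     ≡⟨ cong (_+ b) (sum⇒≡ tS) ⟩
      A + b           ∎

  rdp₀-ηP : ∀ a {A y S} → Sum (γ y) S A → _≤_ U a (inj₂ S) →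
    ∃[ b₁ ] ∃[ c₁ ] (_≤_ U b₁ (inj₂ A) × _≤_ U c₁ (inj₁ y) × USum P Γ b₁ c₁ a)
  rdp₀-ηP _ {A} {y} _ (_ , inPη {a} _) =
    inj₁ a , inj₁ 𝟘 , (inj₂ (A + a) , inPη (sum-+ A a)) , (inj₁ y , inP (neutralˡ y)) , inP (neutralʳ a)
  rdp₀-ηP _ {A} {y} {S} yS (_ , inηP {A'} {t} tS) with conjugation (sum-+ y t)
  ... | w , wy , _ =
    inj₂ (γ y + A') , inj₁ y , (inj₁ w , inηP (≡⇒sum γw+A)) , (inj₁ 𝟘 , inP (neutralʳ y)) , inηP (sum-+ (γ y) A')
    where
    γw+A : γ w + A ≡ γ y + A'
    γw+A = begin
      γ w + A             ≡⟨ cong (γ w +_) (sym (sum⇒≡ yS)) ⟩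
      γ w + (γ y + S)     ≡⟨ sym (+-assoc (γ w) (γ y) S) ⟩
      γ w + γ y + S       ≡⟨ cong (_+ S) (sym (γ-+ w y)) ⟩
      γ (w + y) + S       ≡⟨ cong (λ x → γ x + S) (trans (sum⇒≡ wy) (sym (sum⇒≡ (sum-+ y t)))) ⟩
      γ (y + t) + S       ≡⟨ cong (_+ S) (γ-+ y t) ⟩
      γ y + γ t + S       ≡⟨ +-assoc (γ y) (γ t) S ⟩
      γ y + (γ t + S)     ≡⟨ cong (γ y +_) (sum⇒≡ tS) ⟩
      γ y + A'            ∎

  rdp₀-extend : RDP₀ alg → RDP₀ U
  rdp₀-extend rdp₀ _ (inj₁ b) (inj₁ c) (inj₁ s) (inP bc) (_ , inP a≤s) with rdp₀ _ b c s bc (_ , a≤s)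
  ... | b₁ , c₁ , (x , b₁x) , (y , c₁y) , b₁c₁ =
    inj₁ b₁ , inj₁ c₁ , (inj₁ x , inP b₁x) , (inj₁ y , inP c₁y) , inP b₁c₁
  rdp₀-extend _ a _ _ _ (inPη Sb) a≤S = rdp₀-Pη a Sb a≤S
  rdp₀-extend _ a _ _ _ (inηP yS) a≤S = rdp₀-ηP a yS a≤S

theorem5p3 : (P : GPEA) → Total P → (Γ : UnitizingAutomorphism P) →
    (RDP (GPEA.alg P) ⇔ RDP (Unitization P Γ))
    × (RDP₀ (GPEA.alg P) ⇔ RDP₀ (Unitization P Γ))
    × (RDP₁ (GPEA.alg P) ⇔ RDP₁ (Unitization P Γ))
    × (RDP₂ (GPEA.alg P) ⇔ RDP₂ (Unitization P Γ))
theorem5p3 P total Γ =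
  mk⇔ (λ rdp → from⊤ U (riesz-extend _ (λ _ → tt) (λ _ → tt) (to⊤ alg rdp)))
      (λ rdp → from⊤ alg (riesz-restrict _ (to⊤ U rdp))) ,
  mk⇔ rdp₀-extend rdp₀-restrict ,
  mk⇔ (riesz-extend commuting-lift commuting-zeroˡ commuting-zeroʳ) (riesz-restrict commuting-restrict) ,
  mk⇔ (riesz-extend disjoint-lift disjoint-zeroˡ disjoint-zeroʳ) (riesz-restrict disjoint-restrict)
  where
  open GPEA P using (alg)
  open UnitizationBasics P Γ
  open UnitizationOfTotal P total Γ
  to⊤ : (A : PartialAlg) → RDP A → RieszWith A (λ _ _ → ⊤)
  to⊤ A = Equivalence.to (rdp⇔riesz⊤ A)
  from⊤ : (A : PartialAlg) → RieszWith A (λ _ _ → ⊤) → RDP A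
  from⊤ A = Equivalence.from (rdp⇔riesz⊤ A)
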